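{- Let $G$ and $H$ be graphs each having at least two vertices. (a) If both $G$ and $H$ are connected, then the Cartesian product $G\,\square\,H$ is Class~$0$. (b) If $\delta(G)\ge 2$ and the direct product $G\times H$ is connected, then $G\times H$ is Class~$0$.
   Context: All graphs are finite and simple; $\delta(G)$ is the minimum degree. The Cartesian product $G\,\square\,H$ has vertex set $V(G)\times V(H)$ with $(g,h)\sim(g',h')$ iff either $gg'\in E(G)$ and $h=h'$, or $g=g'$ and $hh'\in E(H)$. The direct product $G\times H$ has vertex set $V(G)\times V(H)$ with $(g,h)\sim(g',h')$ iff $gg'\in E(G)$ and $hh'\in E(H)$. The connected domination game on a connected graph $X$ is played by Dominator and Staller, who alternately select previously unselected vertices, Dominator moving first; each selected vertex must dominate (have in its closed neighborhood) at least one vertex not dominated by previously selected vertices, and at every stage the selected vertices must induce a connected subgraph. The game ends when no legal move exists; Dominator minimizes and Staller maximizes the number of selected vertices; the optimal value is $\gamma_{\rm cg}(X)$. The total connected domination game is the same except each selected vertex must totally dominate (have in its open neighborhood) at least one vertex not yet totally dominated by previously selected vertices; its optimal value is $\gamma_{\rm tcg}(X)$. A connected graph $X$ is Class~$i$ ($i\in\{0,1,2\}$) if $\gamma_{\rm tcg}(X)=\gamma_{\rm cg}(X)+i$. -}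

module Defs where

open import Data.Nat using (ℕ; zero; suc; _+_; _*_; _⊓_; _⊔_; _≤_)
open import Data.Bool using (Bool; true; false; _∧_; _∨_; not; if_then_else_)
open import Data.Fin using (Fin; remQuot; _≟_)
open import Data.List using (List; []; _∷_; length; filter; map; foldr)
open import Data.Bool.ListAction using (any; all)
open import Data.Nat.ListAction using (sum)
open import Data.Bool.Properties using (T?)
open import Data.Product using (_,_; _×_)
open import Relation.Nullary.Decidable using (⌊_⌋)
open import Relation.Binary.PropositionalEquality using (_≡_)
open import Data.List using () renaming (allFin to allFinL)

record RawGraph : Set where
  field
    n   : ℕ
    adj : Fin n → Fin n → Bool
open RawGraph public

record Graph : Set where
  field
    raw    : RawGraph
    sym    : ∀ u v → adj raw u v ≡ adj raw v u
    irrefl : ∀ v → adj raw v v ≡ false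
open Graph public

∣V∣ : Graph → ℕ
∣V∣ G = n (raw G)

deg : (X : RawGraph) → Fin (n X) → ℕ
deg X v = sum (map (λ u → if adj X v u then 1 else 0) (allFinL (n X)))

MinDeg≥ : Graph → ℕ → Set
MinDeg≥ G k = ∀ v → k ≤ deg (raw G) v

data Reach (X : RawGraph) : Fin (n X) → Fin (n X) → Set where
  here : ∀ {v} → Reach X v v
  step : ∀ {u w v} → adj X u w ≡ true → Reach X w v → Reach X u v

record Connected (X : RawGraph) : Set where
  field
    nonempty : 1 ≤ n X
    reach    : ∀ u v → Reach X u v

-- Cartesian product G □ H on Fin (|G| * |H|), vertex combine g h ↔ (g , h)
_□_ : RawGraph → RawGraph → RawGraph
G □ H = record { n = n G * n H ; adj = a }
  where
  a : Fin (n G * n H) → Fin (n G * n H) → Bool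
  a x y with remQuot {n G} (n H) x | remQuot {n G} (n H) y
  ... | g , h | g' , h' = (adj G g g' ∧ ⌊ h ≟ h' ⌋) ∨ (⌊ g ≟ g' ⌋ ∧ adj H h h')

_⊗_ : RawGraph → RawGraph → RawGraph
G ⊗ H = record { n = n G * n H ; adj = a }
  where
  a : Fin (n G * n H) → Fin (n G * n H) → Bool
  a x y with remQuot {n G} (n H) x | remQuot {n G} (n H) y
  ... | g , h | g' , h' = adj G g g' ∧ adj H h h'

module Game (X : RawGraph) where
  V : Set
  V = Fin (n X)

  _==_ : V → V → Bool
  u == v = ⌊ u ≟ v ⌋

  elem : V → List V → Bool
  elem v S = any (_== v) S

  dominated : List V → V → Bool
  dominated S v = any (λ s → (s == v) ∨ adj X s v) S

  tdominated : List V → V → Bool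
  tdominated S v = any (λ s → adj X s v) S

  -- does the list S induce a connected subgraph? (closure from the head,
  -- iterated |S| times, within S; the empty set counts as connected)
  closeStep : List V → List V → List V
  closeStep S R = filter (λ s → T? (elem s R ∨ any (adj X s) R)) S

  iter : ℕ → (List V → List V) → List V → List V
  iter zero    f R = R
  iter (suc k) f R = iter k f (f R)

  inducesConnected : List V → Bool
  inducesConnected []      = true
  inducesConnected (x ∷ S) =
    all (λ s → elem s (iter (length (x ∷ S)) (closeStep (x ∷ S)) (x ∷ [])))
        (x ∷ S)

  legalC : List V → V → Bool
  legalC S v = not (elem v S)
             ∧ any (λ u → ((u == v) ∨ adj X v u) ∧ not (dominated S u)) (allFinL (n X))
             ∧ inducesConnected (v ∷ S)

  legalT : List V → V → Bool
  legalT S v = not (elem v S)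
             ∧ any (λ u → adj X v u ∧ not (tdominated S u)) (allFinL (n X))
             ∧ inducesConnected (v ∷ S)

  data Player : Set where
    Dominator Staller : Player

  other : Player → Player
  other Dominator = Staller
  other Staller   = Dominator

  -- optimal number of selected vertices at the end of the game, from
  -- position S with player p to move; fuel bounds the remaining moves
  -- (|V| suffices since each move selects a new vertex)
  value : (List V → V → Bool) → ℕ → Player → List V → ℕ
  value legal zero    p S = length S
  value legal (suc k) p S with filter (λ v → T? (legal S v)) (allFinL (n X))
  ... | []     = length S
  ... | m ∷ ms = pick p (map (λ v → value legal k (other p) (v ∷ S)) ms)
                        (value legal k (other p) (m ∷ S))
    where
    pick : Player → List ℕ → ℕ → ℕ
    pick Dominator xs x = foldr _⊓_ x xs
    pick Staller   xs x = foldr _⊔_ x xs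

γcg : RawGraph → ℕ
γcg X = value legalC (n X) Dominator []
  where open Game X

γtcg : RawGraph → ℕ
γtcg X = value legalT (n X) Dominator []
  where open Game X

Class0 : RawGraph → Set
Class0 X = γtcg X ≡ γcg X + 0

{-# OPTIONS --safe #-}
module Submission where

-- Call a graph good if it has no isolated vertex and, for every edge wv, w has a
-- neighbour outside N[v].  In a good graph the connected and the total connected
-- domination games have the same legal moves in every position that can arise, so
-- their values agree.  The first move is legal in both games.  A second move w must
-- be adjacent to the first vertex v; it newly dominates a neighbour of w outside
-- N[v] and newly totally dominates v.  From then on the chosen set is connected
-- with at least two vertices, so it totally dominates itself: a vertex is
-- dominated iff it is totally dominated, and w is already totally dominated.
-- G □ H is good when G and H are connected of order at least 2 (for an edge
-- (g,h)(g′,h) take (g,h″) with h″ a neighbour of h), and a connected G × H is good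
-- when δ(G) ≥ 2 (for an edge (g,h)(g′,h′) take (g″,h′) with g″ ≠ g′ a neighbour of g).

open import Defs hiding (sym)
open import Data.Bool using (Bool; true; false; T; not; _∧_; _∨_; if_then_else_)
open import Data.Bool.Properties using (T?; T-∧; T-∨; T-≡; ∧-zeroʳ; ∨-identityʳ)
open import Data.Bool.ListAction using (or; any)
open import Data.Empty using (⊥-elim)
open import Data.Fin using (Fin; zero; suc; _≟_; punchIn; remQuot; combine)
open import Data.Fin.Properties using (punchInᵢ≢i; suc-injective; remQuot-combine)
open import Data.List using (List; []; _∷_; filter; foldr; length; tabulate)
  renaming (allFin to allFinL)
open import Data.List.Membership.Propositional using (_∈_; find; lose)
open import Data.List.Membership.Propositional.Properties using (∈-filter⁻; ∈-allFin)
open import Data.List.Properties using (filter-≐; map-cong; map-cong-local; map-tabulate)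
open import Data.List.Relation.Unary.All as All using (All)
open import Data.List.Relation.Unary.All.Properties using (all⁺)
open import Data.List.Relation.Unary.Any using (here; there)
open import Data.List.Relation.Unary.Any.Properties using (any⁺; any⁻)
open import Data.Nat using (ℕ; zero; suc; _*_; _⊓_; _⊔_; _≤_; s≤s; z≤n)
open import Data.Nat.ListAction using (sum)
open import Data.Nat.Properties using (+-identityʳ; ≤-pred; ≤-trans; *-mono-≤)
open import Data.Product as Product using (∃; _×_; _,_; proj₁; proj₂; uncurry)
open import Data.Sum as Sum using (_⊎_; inj₁; inj₂; [_,_]′)
open import Function using (_∘_; id; _⇔_; mk⇔; Equivalence)
open import Relation.Binary.PropositionalEquality
  using (_≡_; _≢_; _≗_; refl; sym; trans; subst; cong; cong₂)
open import Relation.Nullary using (¬_; yes; no)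
open import Relation.Nullary.Decidable using (⌊_⌋; toWitness; fromWitness)

open Equivalence using (to; from)

T-ext : ∀ {a b} → (T a → T b) → (T b → T a) → a ≡ b
T-ext {false} {false} _ _ = refl
T-ext {false} {true}  _ g = ⊥-elim (g _)
T-ext {true}  {false} f _ = ⊥-elim (f _)
T-ext {true}  {true}  _ _ = refl

T-not : ∀ {a} → T (not a) ⇔ (¬ T a)
T-not {false} = mk⇔ (λ _ ()) (λ _ → _)
T-not {true}  = mk⇔ (λ ()) (λ ¬t → ¬t _)

∧-cong-middle : ∀ a {b b′} c → (T a → T c → b ≡ b′) → a ∧ b ∧ c ≡ a ∧ b′ ∧ c
∧-cong-middle false c _ = refl
∧-cong-middle true {b} {b′} false _ = trans (∧-zeroʳ b) (sym (∧-zeroʳ b′))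
∧-cong-middle true true b≡b′ = cong (_∧ true) (b≡b′ _ _)

module _ {A : Set} (p : A → Bool) where

  any-∈⁺ : ∀ {x xs} → x ∈ xs → T (p x) → T (any p xs)
  any-∈⁺ x∈xs px = any⁺ p (lose x∈xs px)

  any-∈⁻ : ∀ xs → T (any p xs) → ∃ λ x → x ∈ xs × T (p x)
  any-∈⁻ xs t = find (any⁻ p xs t)

module GameProperties (X : RawGraph) where
  open Game X

  ∈⇒elem : ∀ {v S} → v ∈ S → T (elem v S)
  ∈⇒elem v∈S = any-∈⁺ (_== _) v∈S (fromWitness refl)

  elem⇒∈ : ∀ {v S} → T (elem v S) → v ∈ S
  elem⇒∈ {v} {S} t with any-∈⁻ (_== v) S t
  ... | s , s∈S , s==v rewrite toWitness s==v = s∈S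

  iter-preserves : (P : List V → Set) {f : List V → List V} → (∀ {R} → P R → P (f R)) →
                   ∀ k {R} → P R → P (iter k f R)
  iter-preserves P keep zero    pR = pR
  iter-preserves P keep (suc k) pR = iter-preserves P keep k (keep pR)

  module _ (legal₁ legal₂ : List V → V → Bool) (Invariant : List V → Set)
           (legal-≗ : ∀ {S} → Invariant S → legal₁ S ≗ legal₂ S)
           (legal⇒Invariant : ∀ {S v} → Invariant S → T (legal₂ S v) → Invariant (v ∷ S)) where

    moves-≡ : ∀ {S} → Invariant S →
              filter (T? ∘ legal₁ S) (allFinL (n X)) ≡ filter (T? ∘ legal₂ S) (allFinL (n X))
    moves-≡ inv = filter-≐ _ _
      ((λ {v} → subst T (legal-≗ inv v)) , (λ {v} → subst T (sym (legal-≗ inv v))))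
      (allFinL (n X))

    ∈-moves⇒legal : ∀ {S ms v} → filter (T? ∘ legal₂ S) (allFinL (n X)) ≡ ms →
                    v ∈ ms → T (legal₂ S v)
    ∈-moves⇒legal {S} refl v∈ = proj₂ (∈-filter⁻ (T? ∘ legal₂ S) {xs = allFinL (n X)} v∈)

    value-cong : ∀ k p {S} → Invariant S → value legal₁ k p S ≡ value legal₂ k p S
    replies-cong : ∀ k q {S} → Invariant S → ∀ {ms} → (∀ {v} → v ∈ ms → T (legal₂ S v)) →
                   All (λ v → value legal₁ k q (v ∷ S) ≡ value legal₂ k q (v ∷ S)) ms

    value-cong zero    p inv = refl
    value-cong (suc k) p {S} inv
      with filter (T? ∘ legal₁ S) (allFinL (n X))
         | filter (T? ∘ legal₂ S) (allFinL (n X)) in moves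
         | moves-≡ inv
    ... | []     | _ | refl = refl
    ... | m ∷ ms | _ | refl with p | replies-cong k (other p) inv (∈-moves⇒legal moves)
    ... | Dominator | r All.∷ rs = cong₂ (foldr _⊓_) r (map-cong-local rs)
    ... | Staller   | r All.∷ rs = cong₂ (foldr _⊔_) r (map-cong-local rs)

    replies-cong k q inv legal =
      All.tabulate (λ v∈ → value-cong k q (legal⇒Invariant inv (legal v∈)))

module _ {A : Set} (E : A → A → Bool) where

  NoIsolated : Set
  NoIsolated = ∀ w → ∃ λ u → T (E w u)

  PrivateNeighbours : Set
  PrivateNeighbours = ∀ {w v} → T (E w v) → ∃ λ u → T (E w u) × u ≢ v × ¬ T (E v u)

module ClassZero (X : RawGraph)
  (adj-sym : ∀ {u v} → T (adj X u v) → T (adj X v u))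
  (adj-irrefl : ∀ v → ¬ T (adj X v v))
  (noIsolated : NoIsolated (adj X))
  (privateNeighbour : PrivateNeighbours (adj X))
  where
  open Game X
  open GameProperties X

  HasNeighbourIn : List V → V → Set
  HasNeighbourIn L x = ∃ λ y → y ∈ L × T (adj X x y)

  TotallyDominatesItself : List V → Set
  TotallyDominatesItself S = ∀ {s} → s ∈ S → HasNeighbourIn S s

  -- Invariant of the closure that inducesConnected computes from w: a vertex other than w
  -- is only added next to a reached one, so it has a neighbour in L, and the first such
  -- step gives w a neighbour too.
  ReachedFrom : V → List V → List V → Set
  ReachedFrom w L R = ∀ {r} → r ∈ R → r ∈ L × (r ≡ w ⊎ HasNeighbourIn L r × HasNeighbourIn L w)

  closeStep-reachedFrom : ∀ {w L R} → ReachedFrom w L R → ReachedFrom w L (closeStep L R)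
  closeStep-reachedFrom {w} {L} {R} reached s∈
    with ∈-filter⁻ (λ s → T? (elem s R ∨ any (adj X s) R)) {xs = L} s∈
  ... | s∈L , t with to T-∨ t
  ... | inj₁ s∈R = reached (elem⇒∈ s∈R)
  ... | inj₂ s~R with any-∈⁻ (adj X _) R s~R
  ... | r , r∈R , s~r with reached r∈R
  ... | r∈L , inj₁ refl = s∈L , inj₂ ((r , r∈L , s~r) , (_ , s∈L , adj-sym s~r))
  ... | r∈L , inj₂ (_ , w~L) = s∈L , inj₂ ((r , r∈L , s~r) , w~L)

  connected⇒totallyDominatesItself : ∀ {w x S} → ¬ T (elem w (x ∷ S)) →
    T (inducesConnected (w ∷ x ∷ S)) → TotallyDominatesItself (w ∷ x ∷ S)
  connected⇒totallyDominatesItself {w} {x} {S} w∉ connected = λ where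
      (here refl) → proj₂ (neighbours (here refl))
      (there s∈)  → proj₁ (neighbours s∈)
    where
    L = w ∷ x ∷ S
    closure = iter (length L) (closeStep L) (w ∷ [])
    reached : ∀ {s} → s ∈ L → s ∈ L × (s ≡ w ⊎ HasNeighbourIn L s × HasNeighbourIn L w)
    reached s∈ = iter-preserves (ReachedFrom w L) closeStep-reachedFrom (length L) {w ∷ []}
      (λ { (here refl) → here refl , inj₁ refl })
      (elem⇒∈ (All.lookup (all⁺ (λ s → elem s closure) L connected) s∈))
    neighbours : ∀ {s} → s ∈ x ∷ S → HasNeighbourIn L s × HasNeighbourIn L w
    neighbours s∈ with reached (there s∈)
    ... | _ , inj₁ refl = ⊥-elim (w∉ (∈⇒elem s∈))
    ... | _ , inj₂ nb = nb

  data Admissible : List V → Set where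
    empty     : Admissible []
    singleton : ∀ v → Admissible (v ∷ [])
    totallyDominatesItself : ∀ {x y S} → TotallyDominatesItself (x ∷ y ∷ S) → Admissible (x ∷ y ∷ S)

  dominated≡tdominated : ∀ {S} → TotallyDominatesItself S → dominated S ≗ tdominated S
  dominated≡tdominated {S} self u = T-ext dom⇒tdom tdom⇒dom
    where
    dom⇒tdom : T (dominated S u) → T (tdominated S u)
    dom⇒tdom t with any-∈⁻ (λ s → (s == u) ∨ adj X s u) S t
    ... | s , s∈S , s⊢u with to (T-∨ {s == u}) s⊢u | self s∈S
    ... | inj₂ s~u  | _ = any-∈⁺ (λ s → adj X s u) s∈S s~u
    ... | inj₁ s==u | y , y∈S , s~y =
      any-∈⁺ (λ s → adj X s u) y∈S (subst (T ∘ adj X y) (toWitness s==u) (adj-sym s~y))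
    tdom⇒dom : T (tdominated S u) → T (dominated S u)
    tdom⇒dom t with any-∈⁻ (λ s → adj X s u) S t
    ... | s , s∈S , s~u = any-∈⁺ (λ s → (s == u) ∨ adj X s u) s∈S (from T-∨ (inj₂ s~u))

  -- The middle conjuncts of legalC and legalT.
  newlyDominated newlyTDominated : List V → V → V → Bool
  newlyDominated  S w u = ((u == w) ∨ adj X w u) ∧ not (dominated S u)
  newlyTDominated S w u = adj X w u ∧ not (tdominated S u)

  dominatesNew tdominatesNew : List V → V → Bool
  dominatesNew  S w = any (newlyDominated S w) (allFinL (n X))
  tdominatesNew S w = any (newlyTDominated S w) (allFinL (n X))

  dominatesNew-intro : ∀ S w u → T ((u == w) ∨ adj X w u) → ¬ T (dominated S u) →
                       T (dominatesNew S w)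
  dominatesNew-intro S w u u∈N[w] undominated = any-∈⁺ (newlyDominated S w) (∈-allFin u)
    (from (T-∧ {(u == w) ∨ adj X w u}) (u∈N[w] , from T-not undominated))

  tdominatesNew-intro : ∀ S w u → T (adj X w u) → ¬ T (tdominated S u) →
                        T (tdominatesNew S w)
  tdominatesNew-intro S w u w~u undominated = any-∈⁺ (newlyTDominated S w) (∈-allFin u)
    (from (T-∧ {adj X w u}) (w~u , from T-not undominated))

  firstMove-dominatesNew : ∀ w → T (dominatesNew [] w)
  firstMove-dominatesNew w =
    dominatesNew-intro [] w w (from (T-∨ {w == w}) (inj₁ (fromWitness refl))) λ ()

  firstMove-tdominatesNew : ∀ w → T (tdominatesNew [] w)
  firstMove-tdominatesNew w with noIsolated w
  ... | u , w~u = tdominatesNew-intro [] w u w~u λ ()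

  secondMove-dominatesNew : ∀ {v w} → T (adj X w v) → T (dominatesNew (v ∷ []) w)
  secondMove-dominatesNew {v} {w} w~v with privateNeighbour w~v
  ... | u , w~u , u≢v , v≁u =
    dominatesNew-intro (v ∷ []) w u (from (T-∨ {u == w}) (inj₂ w~u)) (v⊬u ∘ subst T (∨-identityʳ _))
    where
    v⊬u : ¬ T ((v == u) ∨ adj X v u)
    v⊬u t = [ u≢v ∘ sym ∘ toWitness , v≁u ]′ (to T-∨ t)

  secondMove-tdominatesNew : ∀ {v w} → T (adj X w v) → T (tdominatesNew (v ∷ []) w)
  secondMove-tdominatesNew {v} {w} w~v =
    tdominatesNew-intro (v ∷ []) w v w~v (adj-irrefl v ∘ subst T (∨-identityʳ _))

  neighbourOfNewVertex : ∀ {w x S} → ¬ T (elem w (x ∷ S)) → T (inducesConnected (w ∷ x ∷ S)) →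
                         HasNeighbourIn (x ∷ S) w
  neighbourOfNewVertex w∉ connected with connected⇒totallyDominatesItself w∉ connected (here refl)
  ... | _ , here refl , w~w = ⊥-elim (adj-irrefl _ w~w)
  ... | y , there y∈S , w~y = y , y∈S , w~y

  dominatesNew≡tdominatesNew : ∀ {S w} → Admissible S → ¬ T (elem w S) →
    T (inducesConnected (w ∷ S)) → dominatesNew S w ≡ tdominatesNew S w
  dominatesNew≡tdominatesNew {w = w} empty _ _ =
    T-ext (λ _ → firstMove-tdominatesNew w) (λ _ → firstMove-dominatesNew w)
  dominatesNew≡tdominatesNew {w = w} (singleton v) w∉ connected
    with neighbourOfNewVertex {w} {v} {[]} w∉ connected
  ... | _ , there () , _
  ... | _ , here refl , w~v =
    T-ext (λ _ → secondMove-tdominatesNew w~v) (λ _ → secondMove-dominatesNew w~v)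
  dominatesNew≡tdominatesNew {S@(x ∷ S′)} {w} (totallyDominatesItself self) w∉ connected =
    cong or (map-cong newlyDominated≡newlyTDominated (allFinL (n X)))
    where
    w-tdominated : T (tdominated S w)
    w-tdominated with neighbourOfNewVertex {w} {x} {S′} w∉ connected
    ... | y , y∈S , w~y = any-∈⁺ (λ s → adj X s w) y∈S (adj-sym w~y)
    newlyDominated≡newlyTDominated : newlyDominated S w ≗ newlyTDominated S w
    newlyDominated≡newlyTDominated u rewrite dominated≡tdominated self u with u ≟ w
    ... | no _ = refl
    ... | yes refl rewrite to T-≡ w-tdominated = sym (∧-zeroʳ (adj X u u))

  legalC≗legalT : ∀ {S} → Admissible S → legalC S ≗ legalT S
  legalC≗legalT {S} admissible w = ∧-cong-middle (not (elem w S)) (inducesConnected (w ∷ S))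
    λ w∉S connected → dominatesNew≡tdominatesNew admissible (to T-not w∉S) connected

  legalT⇒admissible : ∀ {S w} → T (legalT S w) → Admissible (w ∷ S)
  legalT⇒admissible {[]}    {w} _     = singleton w
  legalT⇒admissible {x ∷ S} {w} legal with to (T-∧ {not (elem w (x ∷ S))}) legal
  ... | w∉S , rest with to (T-∧ {tdominatesNew (x ∷ S) w}) rest
  ... | _ , connected =
    totallyDominatesItself (connected⇒totallyDominatesItself (to T-not w∉S) connected)

  class0 : Class0 X
  class0 = trans (sym (value-cong legalC legalT Admissible legalC≗legalT (λ _ → legalT⇒admissible)
                                  (n X) Dominator empty))
                 (sym (+-identityʳ _))

another-vertex : ∀ {m} → 2 ≤ m → (w : Fin m) → ∃ λ w′ → w′ ≢ w
another-vertex (s≤s (s≤s _)) w = punchIn w zero , punchInᵢ≢i w zero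

connected⇒noIsolated : ∀ X → Connected X → 2 ≤ n X → NoIsolated (adj X)
connected⇒noIsolated X connected two w with another-vertex two w
... | w′ , w′≢w = firstStep (Connected.reach connected w w′) w′≢w
  where
  firstStep : ∀ {w w′} → Reach X w w′ → w′ ≢ w → ∃ λ u → T (adj X w u)
  firstStep here         w≢w = ⊥-elim (w≢w refl)
  firstStep (step w~u _) _   = _ , subst T (sym w~u) _

indicatorSum : ∀ {k} → (Fin k → Bool) → ℕ
indicatorSum p = sum (tabulate λ i → if p i then 1 else 0)

deg≡indicatorSum : ∀ X v → deg X v ≡ indicatorSum (adj X v)
deg≡indicatorSum X v = cong sum (map-tabulate id (λ u → if adj X v u then 1 else 0))

indicatorSum-witness : ∀ {k} (p : Fin k → Bool) → 1 ≤ indicatorSum p → ∃ λ i → T (p i)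
indicatorSum-witness {suc k} p sum≥1 with p zero in p0
... | true  = zero , subst T (sym p0) _
... | false with i , pi ← indicatorSum-witness (p ∘ suc) sum≥1 = suc i , pi

indicatorSum-witness≢ : ∀ {k} (p : Fin k → Bool) → 2 ≤ indicatorSum p →
                        ∀ j → ∃ λ i → T (p i) × i ≢ j
indicatorSum-witness≢ {suc k} p sum≥2 j with p zero in p0
indicatorSum-witness≢ {suc k} p sum≥2 (suc _) | true = zero , subst T (sym p0) _ , λ ()
indicatorSum-witness≢ {suc k} p sum≥2 zero    | true
  with i , pi ← indicatorSum-witness (p ∘ suc) (≤-pred sum≥2) = suc i , pi , λ ()
indicatorSum-witness≢ {suc k} p sum≥2 zero    | false
  with i , pi ← indicatorSum-witness (p ∘ suc) (≤-trans (s≤s z≤n) sum≥2) = suc i , pi , λ ()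
indicatorSum-witness≢ {suc k} p sum≥2 (suc j) | false
  with i , pi , i≢j ← indicatorSum-witness≢ (p ∘ suc) sum≥2 j = suc i , pi , i≢j ∘ suc-injective

minDeg2⇒anotherNeighbour : ∀ G → MinDeg≥ G 2 → ∀ g j → ∃ λ u → T (adj (raw G) g u) × u ≢ j
minDeg2⇒anotherNeighbour G minDeg g =
  indicatorSum-witness≢ (adj (raw G) g) (subst (2 ≤_) (deg≡indicatorSum (raw G) g) (minDeg g))

module Pullback {P : Set} (X : RawGraph) (E : P → P → Bool)
  (π : Fin (n X) → P) (ι : P → Fin (n X)) (π∘ι : ∀ p → π (ι p) ≡ p)
  (adj≡E : ∀ x y → adj X x y ≡ E (π x) (π y)) where

  symmetric : (∀ {p q} → T (E p q) → T (E q p)) → ∀ {x y} → T (adj X x y) → T (adj X y x)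
  symmetric E-sym {x} {y} = subst T (sym (adj≡E y x)) ∘ E-sym ∘ subst T (adj≡E x y)

  irreflexive : (∀ p → ¬ T (E p p)) → ∀ x → ¬ T (adj X x x)
  irreflexive E-irrefl x = E-irrefl (π x) ∘ subst T (adj≡E x x)

  adj-ι : ∀ x p → adj X x (ι p) ≡ E (π x) p
  adj-ι x p = trans (adj≡E x (ι p)) (cong (E (π x)) (π∘ι p))

  noIsolated : NoIsolated E → NoIsolated (adj X)
  noIsolated E-noIsolated x with p , πx~p ← E-noIsolated (π x) =
    ι p , subst T (sym (adj-ι x p)) πx~p

  privateNeighbours : PrivateNeighbours E → PrivateNeighbours (adj X)
  privateNeighbours E-private {w} {v} w~v
    with p , πw~p , p≢πv , πv≁p ← E-private (subst T (adj≡E w v) w~v) =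
    ι p , subst T (sym (adj-ι w p)) πw~p , p≢πv ∘ trans (sym (π∘ι p)) ∘ cong π ,
    πv≁p ∘ subst T (adj-ι v p)

graph-sym : ∀ G {u v} → T (adj (raw G) u v) → T (adj (raw G) v u)
graph-sym G {u} {v} = subst T (Graph.sym G u v)

graph-irrefl : ∀ G v → ¬ T (adj (raw G) v v)
graph-irrefl G v = subst T (Graph.irrefl G v)

cartesianAdj directAdj : (G H : RawGraph) → Fin (n G) × Fin (n H) → Fin (n G) × Fin (n H) → Bool
cartesianAdj G H (g , h) (g′ , h′) = (adj G g g′ ∧ ⌊ h ≟ h′ ⌋) ∨ (⌊ g ≟ g′ ⌋ ∧ adj H h h′)
directAdj    G H (g , h) (g′ , h′) = adj G g g′ ∧ adj H h h′

□-adj : ∀ G H x y → adj (G □ H) x y ≡ cartesianAdj G H (remQuot (n H) x) (remQuot (n H) y)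
□-adj G H x y with remQuot {n G} (n H) x | remQuot {n G} (n H) y
... | _ , _ | _ , _ = refl

⊗-adj : ∀ G H x y → adj (G ⊗ H) x y ≡ directAdj G H (remQuot (n H) x) (remQuot (n H) y)
⊗-adj G H x y with remQuot {n G} (n H) x | remQuot {n G} (n H) y
... | _ , _ | _ , _ = refl

CartesianEdge : (G H : RawGraph) → Fin (n G) × Fin (n H) → Fin (n G) × Fin (n H) → Set
CartesianEdge G H (g , h) (g′ , h′) = T (adj G g g′) × h ≡ h′ ⊎ g ≡ g′ × T (adj H h h′)

cartesianAdj⇔ : ∀ {G H} p q → T (cartesianAdj G H p q) ⇔ CartesianEdge G H p q
cartesianAdj⇔ {G} (g , h) (g′ , h′) = mk⇔
  (Sum.map (Product.map₂ toWitness ∘ to (T-∧ {adj G g g′})) (Product.map₁ toWitness ∘ to T-∧)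
     ∘ to (T-∨ {adj G g g′ ∧ ⌊ h ≟ h′ ⌋}))
  (from T-∨ ∘ Sum.map (from (T-∧ {adj G g g′}) ∘ Product.map₂ fromWitness)
                      (from T-∧ ∘ Product.map₁ fromWitness))

DirectEdge : (G H : RawGraph) → Fin (n G) × Fin (n H) → Fin (n G) × Fin (n H) → Set
DirectEdge G H (g , h) (g′ , h′) = T (adj G g g′) × T (adj H h h′)

directAdj⇔ : ∀ {G H} p q → T (directAdj G H p q) ⇔ DirectEdge G H p q
directAdj⇔ {G} (g , _) (g′ , _) = T-∧ {adj G g g′}

module CartesianProduct (G H : Graph) where
  private
    E = cartesianAdj (raw G) (raw H)

    edge⇔ : ∀ p q → T (E p q) ⇔ CartesianEdge (raw G) (raw H) p q
    edge⇔ = cartesianAdj⇔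

  symmetric : ∀ {p q} → T (E p q) → T (E q p)
  symmetric {p} {q} = from (edge⇔ q p)
    ∘ Sum.map (Product.map (graph-sym G) sym) (Product.map sym (graph-sym H)) ∘ to (edge⇔ p q)

  irreflexive : ∀ p → ¬ T (E p p)
  irreflexive p@(g , h) = [ graph-irrefl G g ∘ proj₁ , graph-irrefl H h ∘ proj₂ ]′ ∘ to (edge⇔ p p)

  noIsolated : NoIsolated (adj (raw G)) → NoIsolated E
  noIsolated G-noIsolated (g , h) with g′ , g~g′ ← G-noIsolated g =
    (g′ , h) , from (edge⇔ (g , h) (g′ , h)) (inj₁ (g~g′ , refl))

  privateNeighbours : NoIsolated (adj (raw G)) → NoIsolated (adj (raw H)) → PrivateNeighbours E
  privateNeighbours G-noIsolated H-noIsolated {g , h} {g′ , h′} e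
    with to (edge⇔ (g , h) (g′ , h′)) e
  ... | inj₁ (g~g′ , refl) with h″ , h~h″ ← H-noIsolated h =
    (g , h″) , from (edge⇔ (g , h) (g , h″)) (inj₂ (refl , h~h″)) ,
    (λ { refl → graph-irrefl G g g~g′ }) ,
    [ (λ { (_ , refl) → graph-irrefl H h h~h″ }) , (λ { (refl , _) → graph-irrefl G g g~g′ }) ]′
      ∘ to (edge⇔ (g′ , h) (g , h″))
  ... | inj₂ (refl , h~h′) with g″ , g~g″ ← G-noIsolated g =
    (g″ , h) , from (edge⇔ (g , h) (g″ , h)) (inj₁ (g~g″ , refl)) ,
    (λ { refl → graph-irrefl H h h~h′ }) ,
    [ (λ { (_ , refl) → graph-irrefl H h h~h′ }) , (λ { (refl , _) → graph-irrefl G g g~g″ }) ]′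
      ∘ to (edge⇔ (g , h′) (g″ , h))

  class0 : 2 ≤ ∣V∣ G → 2 ≤ ∣V∣ H → Connected (raw G) → Connected (raw H) → Class0 (raw G □ raw H)
  class0 twoG twoH connectedG connectedH =
    ClassZero.class0 (raw G □ raw H) (P.symmetric symmetric) (P.irreflexive irreflexive)
      (P.noIsolated (noIsolated G-noIsolated))
      (P.privateNeighbours (privateNeighbours G-noIsolated H-noIsolated))
    where
    module P = Pullback (raw G □ raw H) E (remQuot (∣V∣ H)) (uncurry combine)
                 (uncurry remQuot-combine) (□-adj (raw G) (raw H))
    G-noIsolated = connected⇒noIsolated (raw G) connectedG twoG
    H-noIsolated = connected⇒noIsolated (raw H) connectedH twoH

module DirectProduct (G H : Graph) where
  private
    E = directAdj (raw G) (raw H)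

    edge⇔ : ∀ p q → T (E p q) ⇔ DirectEdge (raw G) (raw H) p q
    edge⇔ = directAdj⇔

  symmetric : ∀ {p q} → T (E p q) → T (E q p)
  symmetric {p} {q} = from (edge⇔ q p) ∘ Product.map (graph-sym G) (graph-sym H) ∘ to (edge⇔ p q)

  irreflexive : ∀ p → ¬ T (E p p)
  irreflexive p = graph-irrefl G (proj₁ p) ∘ proj₁ ∘ to (edge⇔ p p)

  privateNeighbours : MinDeg≥ G 2 → PrivateNeighbours E
  privateNeighbours minDeg {g , h} {g′ , h′} e
    with g″ , g~g″ , g″≢g′ ← minDeg2⇒anotherNeighbour G minDeg g g′ =
    (g″ , h′) , from (edge⇔ (g , h) (g″ , h′)) (g~g″ , proj₂ (to (edge⇔ (g , h) (g′ , h′)) e)) ,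
    g″≢g′ ∘ cong proj₁ , graph-irrefl H h′ ∘ proj₂ ∘ to (edge⇔ (g′ , h′) (g″ , h′))

  class0 : 2 ≤ ∣V∣ G → 2 ≤ ∣V∣ H → MinDeg≥ G 2 → Connected (raw G ⊗ raw H) → Class0 (raw G ⊗ raw H)
  class0 twoG twoH minDeg connected =
    ClassZero.class0 (raw G ⊗ raw H) (P.symmetric symmetric) (P.irreflexive irreflexive)
      (connected⇒noIsolated (raw G ⊗ raw H) connected two≤n)
      (P.privateNeighbours (privateNeighbours minDeg))
    where
    module P = Pullback (raw G ⊗ raw H) E (remQuot (∣V∣ H)) (uncurry combine)
                 (uncurry remQuot-combine) (⊗-adj (raw G) (raw H))
    two≤n : 2 ≤ ∣V∣ G * ∣V∣ H
    two≤n = ≤-trans (s≤s (s≤s z≤n)) (*-mono-≤ twoG twoH)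

corollary3p2 : (G H : Graph) → 2 ≤ ∣V∣ G → 2 ≤ ∣V∣ H →
    ((Connected (raw G) → Connected (raw H) → Class0 (raw G □ raw H))
    × (MinDeg≥ G 2 → Connected (raw G ⊗ raw H) → Class0 (raw G ⊗ raw H)))
corollary3p2 G H twoG twoH =
  CartesianProduct.class0 G H twoG twoH , DirectProduct.class0 G H twoG twoH
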